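{- Let $n\ge2$. If $\lambda$ is a cup or a cap of size $m\ge3$, i.e. $\lambda=(m-1),1,2,\dots,(m-2),m$ or $\lambda=1,3,4,\dots,m,2$, then $\lambda$ is vanishing, i.e. $\mu(21,\lambda)\cdot\sum_{\tau\in[\lambda,\pi_n]}(-1)^{|\tau|}E(\tau,\pi_n)=0$.
   Context: Permutations of size $n$ are bijections of $[n]$ written as value sequences. An embedding of $\sigma\in\mathcal{S}_k$ into $\pi\in\mathcal{S}_N$ is a strictly increasing $f\colon[k]\to[N]$ with $\pi(f(1)),\dots,\pi(f(k))$ order-isomorphic to $\sigma$; $E(\sigma,\pi)$ is the number of embeddings; $\sigma\le\pi$ iff $E(\sigma,\pi)>0$; $[x,y]=\{z:x\le z\le y\}$; $\mu$ is the Möbius function of this poset ($\mu(x,y)=0$ if $x\not\le y$, $\mu(x,x)=1$, $\mu(x,y)=-\sum_{x\le z<y}\mu(x,z)$ for $x<y$). For $n\ge1$, $\pi_n\in\mathcal{S}_{2n+2}$ is given by $\pi_n(1)=n+1$, $\pi_n(2i)=i$ and $\pi_n(2i+1)=n+2+i$ for $1\le i\le n$, $\pi_n(2n+2)=n+2$. -}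

module Defs where

open import Data.Nat as ℕ using (ℕ; zero; suc; _<?_; _∸_)
open import Data.Integer as ℤ using (ℤ; +_; -_; _*_)
open import Data.List using (List; []; _∷_; _++_; map; length; filter; upTo; concatMap; foldr; deduplicate)
open import Data.List.Properties using (≡-dec)
open import Data.Bool using (Bool; if_then_else_; T?)
open import Relation.Nullary using (Dec)
open import Relation.Nullary.Decidable using (⌊_⌋; ¬?)
open import Relation.Binary.PropositionalEquality using (_≡_)

-- Permutations (and, more generally, sequences of distinct naturals)
-- are written as value sequences, e.g. 2 ∷ 1 ∷ [] is the permutation 21.
Perm : Set
Perm = List ℕ

_≟ₗ_ : (xs ys : List ℕ) → Dec (xs ≡ ys)
_≟ₗ_ = ≡-dec ℕ._≟_

countBelow : ℕ → List ℕ → ℕ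
countBelow x s = length (filter (_<? x) s)

-- standardisation: replace each entry by its rank (1-based);
-- two sequences of distinct values are order-isomorphic iff their std agree
std : List ℕ → List ℕ
std s = map (λ x → suc (countBelow x s)) s

-- all subsequences, one for every strictly increasing index choice f
subseqs : List ℕ → List (List ℕ)
subseqs [] = [] ∷ []
subseqs (x ∷ xs) = map (x ∷_) (subseqs xs) ++ subseqs xs

E : Perm → Perm → ℕ
E σ π = length (filter (λ s → std s ≟ₗ std σ) (subseqs π))

leq : Perm → Perm → Bool
leq σ π = ⌊ 0 <? E σ π ⌋

patterns : Perm → List Perm
patterns π = deduplicate _≟ₗ_ (map std (subseqs π))

interval : Perm → Perm → List Perm
interval x y = filter (λ z → T? (leq x z)) (patterns y)

sumℤ : List ℤ → ℤ
sumℤ = foldr ℤ._+_ (+ 0)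

-- Möbius function, with fuel bounding the recursion depth.
-- Every z < y in the pattern poset is strictly shorter than y, so
-- fuel = suc (length y) suffices (see μ below).
μ-fuel : ℕ → Perm → Perm → ℤ
μ-fuel zero x y = + 0
μ-fuel (suc k) x y =
  if ⌊ x ≟ₗ y ⌋ then + 1
  else (if leq x y
        then - sumℤ (map (μ-fuel k x)
                      (filter (λ z → ¬? (z ≟ₗ y)) (interval x y)))
        else + 0)

μ : Perm → Perm → ℤ
μ x y = μ-fuel (suc (length y)) x y

sign : ℕ → ℤ
sign zero = + 1
sign (suc k) = - sign k

-- π_n ∈ S_{2n+2}: π_n(1)=n+1, π_n(2i)=i, π_n(2i+1)=n+2+i (1≤i≤n), π_n(2n+2)=n+2
πₙ : ℕ → Perm
πₙ n = suc n ∷ concatMap (λ i → i ∷ (n ℕ.+ 2 ℕ.+ i) ∷ []) (map suc (upTo n))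
         ++ (n ℕ.+ 2 ∷ [])

cup : ℕ → Perm
cup m = (m ∸ 1) ∷ map suc (upTo (m ∸ 2)) ++ (m ∷ [])

cap : ℕ → Perm
cap m = 1 ∷ map (λ i → i ℕ.+ 3) (upTo (m ∸ 2)) ++ (2 ∷ [])

p21 : Perm
p21 = 2 ∷ 1 ∷ []

Vanishing : ℕ → Perm → Set
Vanishing n lam =
  μ p21 lam * sumℤ (map (λ τ → sign (length τ) * (+ E τ (πₙ n))) (interval lam (πₙ n)))
    ≡ + 0

-- E τ πₙ counts the subsequences of πₙ whose pattern is τ, so the interval sum equals the sum
-- of (-1)^|s| over the subsequences s of πₙ that contain λ.  Write πₙ = A Mid B with A = n+1,
-- B = n+2 and Mid = 1 (n+3) 2 (n+4) … n (2n+2): every entry of Mid is low (≤ n) or above B, and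
-- its only inversions put a high entry before a low one.  Group the subsequences of πₙ as AuB,
-- uB, Au, u for u ⊆ Mid.  For a cup or cap λ, containing λ in one of these is either equivalent
-- to containing it in u, and the two terms cancel, or to u containing a fixed word of lows and
-- highs: all lows (cup in AuB), lows then one high (cup in Au), all highs (cap in AuB), one low
-- then highs (cap in uB).  Each such word is lowsᵃ highsᵇ, and since Mid starts low, high, low,
-- the alternating sum over u ⊆ Mid of "u contains the word" vanishes: after dropping the leading
-- entries the word must use, one reaches an entry it ignores, and adding or removing that entry
-- is a sign-reversing involution.

module Submission where

open import Defs
open import Data.Nat using (ℕ; zero; suc; _+_; _≤_; _<_; z≤n; s≤s; _<?_; _≤?_)
import Data.Nat.Properties as ℕP
open import Data.Integer using (ℤ; +_; -_) renaming (_+_ to _+ℤ_; _*_ to _*ℤ_)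
import Data.Integer.Properties as ℤP
open import Data.Integer.Tactic.RingSolver using (solve-∀)
import Data.Bool as Bool
open import Data.Bool using (Bool; true; false; if_then_else_; T; T?)
open import Data.List using (List; []; _∷_; _++_; replicate; map; length; filter; upTo; applyUpTo; concatMap; deduplicate)
import Data.List.Properties as LP
open import Data.List.Relation.Unary.All as All using (All; []; _∷_)
import Data.List.Relation.Unary.All.Properties as AllP
open import Data.List.Relation.Unary.Any using (Any; here; there)
import Data.List.Relation.Unary.Any.Properties as AnyP
open import Data.List.Relation.Unary.AllPairs as AllPairs using (AllPairs; []; _∷_)
import Data.List.Relation.Unary.AllPairs.Properties as AllPairsP
open import Data.List.Relation.Unary.Unique.Propositional using (Unique)
open import Data.List.Relation.Unary.Unique.DecPropositional.Properties _≟ₗ_ using (deduplicate-!)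
open import Data.List.Membership.Propositional using (_∈_; _∉_; find; lose)
open import Data.List.Membership.Propositional.Properties using (∈-map⁺; ∈-map⁻; ∈-++⁺ˡ; ∈-++⁺ʳ; ∈-++⁻)
open import Data.List.Relation.Binary.Sublist.Propositional {A = ℕ}
  using (_⊆_; []; _∷_; _∷ʳ_; ⊆-refl; ⊆-trans; minimum; lookup)
open import Data.List.Relation.Binary.Sublist.Propositional.Properties using (All-resp-⊆)
import Data.List.Relation.Binary.Sublist.Heterogeneous.Properties as ⊆P
open import Data.Product using (∃; _×_; _,_; proj₁; proj₂)
open import Data.Sum using (_⊎_; inj₁; inj₂)
open import Data.Empty using (⊥; ⊥-elim)
open import Function using (_∘_; _⇔_; mk⇔; Equivalence)
open import Relation.Nullary using (Dec; yes; no; ¬_; does)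
open import Relation.Nullary.Decidable using (⌊_⌋; does-⇔; dec-true; dec-false)
open import Relation.Binary.PropositionalEquality

-- Sums over lists

∑ : {A : Set} → (A → ℤ) → List A → ℤ
∑ f xs = sumℤ (map f xs)

∑-++ : {A : Set} (f : A → ℤ) (xs ys : List A) → ∑ f (xs ++ ys) ≡ ∑ f xs +ℤ ∑ f ys
∑-++ f [] ys = sym (ℤP.+-identityˡ _)
∑-++ f (x ∷ xs) ys = trans (cong (f x +ℤ_) (∑-++ f xs ys)) (sym (ℤP.+-assoc (f x) _ _))

∑-map : {A B : Set} (f : B → ℤ) (g : A → B) (xs : List A) → ∑ f (map g xs) ≡ ∑ (f ∘ g) xs
∑-map f g xs = cong sumℤ (sym (LP.map-∘ xs))

∑-cong : {A : Set} {f g : A → ℤ} (xs : List A) → (∀ x → x ∈ xs → f x ≡ g x) → ∑ f xs ≡ ∑ g xs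
∑-cong [] eq = refl
∑-cong (x ∷ xs) eq = cong₂ _+ℤ_ (eq x (here refl)) (∑-cong xs (λ y y∈ → eq y (there y∈)))

∑-+ : {A : Set} (f g : A → ℤ) (xs : List A) → ∑ (λ x → f x +ℤ g x) xs ≡ ∑ f xs +ℤ ∑ g xs
∑-+ f g [] = refl
∑-+ f g (x ∷ xs) = trans (cong (f x +ℤ g x +ℤ_) (∑-+ f g xs)) (interchange (f x) (g x) _ _)
  where
  interchange : ∀ a b c d → (a +ℤ b) +ℤ (c +ℤ d) ≡ (a +ℤ c) +ℤ (b +ℤ d)
  interchange = solve-∀

∑-neg : {A : Set} (f : A → ℤ) (xs : List A) → ∑ (λ x → - f x) xs ≡ - ∑ f xs
∑-neg f [] = refl
∑-neg f (x ∷ xs) = trans (cong (- f x +ℤ_) (∑-neg f xs)) (sym (ℤP.neg-distrib-+ (f x) (∑ f xs)))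

∑-zero : {A : Set} (xs : List A) → ∑ (λ _ → + 0) xs ≡ + 0
∑-zero [] = refl
∑-zero (x ∷ xs) = trans (ℤP.+-identityˡ _) (∑-zero xs)

infixr 8 [_]·_

[_]·_ : Bool → ℤ → ℤ
[ true ]· z = z
[ false ]· z = + 0

[]·-neg : ∀ b z → [ b ]· (- z) ≡ - [ b ]· z
[]·-neg true z = refl
[]·-neg false z = refl

[]·-* : ∀ b c z → [ b ]· (c *ℤ z) ≡ ([ b ]· c) *ℤ z
[]·-* true c z = refl
[]·-* false c z = sym (ℤP.*-zeroˡ z)

≡true⇔⇒≡ : ∀ {b c : Bool} → b ≡ true ⇔ c ≡ true → b ≡ c
≡true⇔⇒≡ {true} {true} _ = refl
≡true⇔⇒≡ {true} {false} b⇔c = sym (Equivalence.to b⇔c refl)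
≡true⇔⇒≡ {false} {true} b⇔c = Equivalence.from b⇔c refl
≡true⇔⇒≡ {false} {false} _ = refl

module _ {A : Set} {P : A → Set} (P? : (x : A) → Dec (P x)) where

  ∑-filter : (f : A → ℤ) (xs : List A) → ∑ f (filter P? xs) ≡ ∑ (λ x → [ does (P? x) ]· f x) xs
  ∑-filter f [] = refl
  ∑-filter f (x ∷ xs) with does (P? x)
  ... | true = cong (f x +ℤ_) (∑-filter f xs)
  ... | false = trans (∑-filter f xs) (sym (ℤP.+-identityˡ _))

  filter-nonempty : (xs : List A) → 0 < length (filter P? xs) → Any P xs
  filter-nonempty (x ∷ xs) nonempty with P? x
  ... | yes px = here px
  ... | no _ = there (filter-nonempty xs nonempty)

length-filter-map : {A B : Set} {P : B → Set} (P? : (x : B) → Dec (P x)) (g : A → B) (xs : List A) →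
  length (filter P? (map g xs)) ≡ length (filter (P? ∘ g) xs)
length-filter-map P? g [] = refl
length-filter-map P? g (x ∷ xs) with does (P? (g x))
... | true = cong suc (length-filter-map P? g xs)
... | false = length-filter-map P? g xs

length-filter-cong : {A : Set} {P Q : A → Set} (P? : (x : A) → Dec (P x)) (Q? : (x : A) → Dec (Q x)) (xs : List A) →
  (∀ x → x ∈ xs → does (P? x) ≡ does (Q? x)) → length (filter P? xs) ≡ length (filter Q? xs)
length-filter-cong P? Q? [] eq = refl
length-filter-cong P? Q? (x ∷ xs) eq with does (P? x) | does (Q? x) | eq x (here refl)
... | true | true | _ = cong suc (length-filter-cong P? Q? xs (λ y y∈ → eq y (there y∈)))
... | false | false | _ = length-filter-cong P? Q? xs (λ y y∈ → eq y (there y∈))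

map≡replicate⇔ : {A B : Set} (f : A → B) (b : B) (k : ℕ) (ys : List A) →
  map f ys ≡ replicate k b ⇔ (All (λ y → f y ≡ b) ys × length ys ≡ k)
map≡replicate⇔ f b k ys = mk⇔ (to k ys) (λ (fys≡b , len) → from ys fys≡b len)
  where
  to : ∀ k ys → map f ys ≡ replicate k b → All (λ y → f y ≡ b) ys × length ys ≡ k
  to zero [] _ = [] , refl
  to (suc k) (y ∷ ys) eq with to k ys (LP.∷-injectiveʳ eq)
  ... | fys≡b , len = LP.∷-injectiveˡ eq ∷ fys≡b , cong suc len
  from : ∀ {k} ys → All (λ y → f y ≡ b) ys → length ys ≡ k → map f ys ≡ replicate k b
  from [] [] refl = refl
  from (y ∷ ys) (fy≡b ∷ fys≡b) refl = cong₂ _∷_ fy≡b (from ys fys≡b refl)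

map-++⁻ : {A B : Set} (f : A → B) (xs : List A) (bs cs : List B) → map f xs ≡ bs ++ cs →
  ∃ λ xs₁ → ∃ λ xs₂ → xs ≡ xs₁ ++ xs₂ × map f xs₁ ≡ bs × map f xs₂ ≡ cs
map-++⁻ f xs [] cs eq = [] , xs , refl , refl , eq
map-++⁻ f (x ∷ xs) (b ∷ bs) cs eq with map-++⁻ f xs bs cs (LP.∷-injectiveʳ eq)
... | xs₁ , xs₂ , refl , eq₁ , eq₂ = x ∷ xs₁ , xs₂ , refl , cong₂ _∷_ (LP.∷-injectiveˡ eq) eq₁ , eq₂

δ : List ℕ → List ℕ → ℤ
δ x y = [ does (x ≟ₗ y) ]· + 1

∑-δ-∉ : (h : List ℕ → ℤ) {x : List ℕ} (D : List (List ℕ)) → x ∉ D → ∑ (λ τ → h τ *ℤ δ x τ) D ≡ + 0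
∑-δ-∉ h [] x∉ = refl
∑-δ-∉ h {x} (τ ∷ D) x∉ with x ≟ₗ τ
... | yes refl = ⊥-elim (x∉ (here refl))
... | no _ = trans (cong (_+ℤ _) (ℤP.*-zeroʳ (h τ))) (trans (ℤP.+-identityˡ _) (∑-δ-∉ h D (x∉ ∘ there)))

∑-δ-∈ : (h : List ℕ → ℤ) {x : List ℕ} (D : List (List ℕ)) → Unique D → x ∈ D →
  ∑ (λ τ → h τ *ℤ δ x τ) D ≡ h x
∑-δ-∈ h {x} (τ ∷ D) (τ∉D ∷ unique) x∈ with x ≟ₗ τ | x∈
... | yes refl | _ = trans (cong₂ _+ℤ_ (ℤP.*-identityʳ (h x)) (∑-δ-∉ h D (λ x∈D → All.lookup τ∉D x∈D refl)))
                          (ℤP.+-identityʳ (h x))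
... | no x≢τ | here x≡τ = ⊥-elim (x≢τ x≡τ)
... | no _ | there x∈D = trans (cong (_+ℤ _) (ℤP.*-zeroʳ (h τ))) (trans (ℤP.+-identityˡ _) (∑-δ-∈ h D unique x∈D))

∑-fibres : {A : Set} (g : A → List ℕ) (h : List ℕ → ℤ) (D : List (List ℕ)) → Unique D →
  (S : List A) → (∀ s → s ∈ S → g s ∈ D) →
  ∑ (λ τ → h τ *ℤ + length (filter (λ s → g s ≟ₗ τ) S)) D ≡ ∑ (h ∘ g) S
∑-fibres g h D unique [] covers = trans (∑-cong D (λ τ _ → ℤP.*-zeroʳ (h τ))) (∑-zero D)
∑-fibres g h D unique (s ∷ S) covers = begin
  ∑ (λ τ → h τ *ℤ + length (filter (λ s → g s ≟ₗ τ) (s ∷ S))) D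
    ≡⟨ ∑-cong D (λ τ _ → split τ) ⟩
  ∑ (λ τ → h τ *ℤ δ (g s) τ +ℤ h τ *ℤ + length (filter (λ s → g s ≟ₗ τ) S)) D
    ≡⟨ ∑-+ _ _ D ⟩
  ∑ (λ τ → h τ *ℤ δ (g s) τ) D +ℤ ∑ (λ τ → h τ *ℤ + length (filter (λ s → g s ≟ₗ τ) S)) D
    ≡⟨ cong₂ _+ℤ_ (∑-δ-∈ h D unique (covers s (here refl)))
                  (∑-fibres g h D unique S (λ s′ s′∈ → covers s′ (there s′∈))) ⟩
  h (g s) +ℤ ∑ (h ∘ g) S ∎
  where
  open ≡-Reasoning
  split : ∀ τ → h τ *ℤ + length (filter (λ s → g s ≟ₗ τ) (s ∷ S))
              ≡ h τ *ℤ δ (g s) τ +ℤ h τ *ℤ + length (filter (λ s → g s ≟ₗ τ) S)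
  split τ with g s ≟ₗ τ
  ... | yes _ = ℤP.*-distribˡ-+ (h τ) (+ 1) _
  ... | no _ = sym (trans (cong (_+ℤ rest) (ℤP.*-zeroʳ (h τ))) (ℤP.+-identityˡ rest))
    where
    rest : ℤ
    rest = h τ *ℤ + length (filter (λ s → g s ≟ₗ τ) S)

-- Standardisation

countBelow-∷-< : ∀ {a y} s → y < a → countBelow a (y ∷ s) ≡ suc (countBelow a s)
countBelow-∷-< {a} s y<a = cong length (LP.filter-accept (_<? a) y<a)

countBelow-∷-≮ : ∀ {a y} s → ¬ y < a → countBelow a (y ∷ s) ≡ countBelow a s
countBelow-∷-≮ {a} s y≮a = cong length (LP.filter-reject (_<? a) y≮a)

countBelow-mono : ∀ {a b} s → b ≤ a → countBelow b s ≤ countBelow a s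
countBelow-mono [] _ = z≤n
countBelow-mono {a} {b} (y ∷ s) b≤a with y <? b | y <? a
... | yes y<b | yes y<a rewrite countBelow-∷-< s y<b | countBelow-∷-< s y<a = s≤s (countBelow-mono s b≤a)
... | yes y<b | no y≮a = ⊥-elim (y≮a (ℕP.<-≤-trans y<b b≤a))
... | no y≮b | yes y<a rewrite countBelow-∷-≮ s y≮b | countBelow-∷-< s y<a = ℕP.m≤n⇒m≤1+n (countBelow-mono s b≤a)
... | no y≮b | no y≮a rewrite countBelow-∷-≮ s y≮b | countBelow-∷-≮ s y≮a = countBelow-mono s b≤a

countBelow-strict : ∀ {a b} s → a ∈ s → a < b → suc (countBelow a s) ≤ countBelow b s
countBelow-strict {a} {b} (y ∷ s) a∈ a<b with y <? a | y <? b | a∈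
... | yes y<a | yes y<b | here refl = ⊥-elim (ℕP.<-irrefl refl y<a)
... | yes y<a | yes y<b | there a∈s rewrite countBelow-∷-< s y<a | countBelow-∷-< s y<b = s≤s (countBelow-strict s a∈s a<b)
... | yes y<a | no y≮b | _ = ⊥-elim (y≮b (ℕP.<-trans y<a a<b))
... | no y≮a | yes y<b | here refl rewrite countBelow-∷-≮ s y≮a | countBelow-∷-< s y<b = s≤s (countBelow-mono s (ℕP.<⇒≤ a<b))
... | no y≮a | yes y<b | there a∈s rewrite countBelow-∷-≮ s y≮a | countBelow-∷-< s y<b =
  ℕP.m≤n⇒m≤1+n (countBelow-strict s a∈s a<b)
... | no y≮a | no y≮b | here refl = ⊥-elim (y≮b a<b)
... | no y≮a | no y≮b | there a∈s rewrite countBelow-∷-≮ s y≮a | countBelow-∷-≮ s y≮b = countBelow-strict s a∈s a<b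

countBelow-++ : ∀ a xs ys → countBelow a (xs ++ ys) ≡ countBelow a xs + countBelow a ys
countBelow-++ a xs ys = trans (cong length (LP.filter-++ (_<? a) xs ys)) (LP.length-++ (filter (_<? a) xs))

countBelow-all : ∀ {a ys} → All (_< a) ys → countBelow a ys ≡ length ys
countBelow-all {a} ys<a = cong length (LP.filter-all (_<? a) ys<a)

countBelow-none : ∀ {a ys} → All (λ y → ¬ y < a) ys → countBelow a ys ≡ 0
countBelow-none {a} ys≮a = cong length (LP.filter-none (_<? a) ys≮a)

countBelow-increasing : ∀ ys → AllPairs _<_ ys → map (λ y → countBelow y ys) ys ≡ upTo (length ys)
countBelow-increasing [] [] = refl
countBelow-increasing (y ∷ ys) (y<ys ∷ increasing) = cong₂ _∷_
  (trans (countBelow-∷-≮ ys (ℕP.<-irrefl refl)) (countBelow-none (All.map (λ y<b b<y → ℕP.<-asym y<b b<y) y<ys)))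
  (begin
    map (λ b → countBelow b (y ∷ ys)) ys ≡⟨ LP.map-cong-local (All.map (countBelow-∷-< ys) y<ys) ⟩
    map (λ b → suc (countBelow b ys)) ys  ≡⟨ LP.map-∘ ys ⟩
    map suc (map (λ b → countBelow b ys) ys) ≡⟨ cong (map suc) (countBelow-increasing ys increasing) ⟩
    map suc (upTo (length ys))            ≡⟨ LP.map-applyUpTo (λ i → i) suc (length ys) ⟩
    applyUpTo suc (length ys) ∎)
  where open ≡-Reasoning

countBelow-framed : ∀ a x ys z →
  countBelow a (x ∷ ys ++ z ∷ []) ≡ countBelow a (x ∷ []) + (countBelow a ys + countBelow a (z ∷ []))
countBelow-framed a x ys z =
  trans (countBelow-++ a (x ∷ []) (ys ++ z ∷ [])) (cong (_+_ (countBelow a (x ∷ []))) (countBelow-++ a ys (z ∷ [])))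

countBelow-[<] : ∀ {a y} → y < a → countBelow a (y ∷ []) ≡ 1
countBelow-[<] y<a = countBelow-all (y<a ∷ [])

countBelow-[≮] : ∀ {a y} → ¬ y < a → countBelow a (y ∷ []) ≡ 0
countBelow-[≮] y≮a = countBelow-none (y≮a ∷ [])

rank : List ℕ → ℕ → ℕ
rank s x = suc (countBelow x s)

rank-mono-< : ∀ s {a b} → a ∈ s → a < b → rank s a < rank s b
rank-mono-< s a∈ a<b = s≤s (countBelow-strict s a∈ a<b)

rank-cancel-< : ∀ s {a b} → rank s a < rank s b → a < b
rank-cancel-< s {a} {b} ra<rb with a <? b
... | yes a<b = a<b
... | no a≮b = ⊥-elim (ℕP.<⇒≱ ra<rb (s≤s (countBelow-mono s (ℕP.≮⇒≥ a≮b))))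

std-map-mono : (g : ℕ → ℕ) (t : List ℕ) →
  (∀ {a b} → a ∈ t → b ∈ t → (a < b → g a < g b) × (g a < g b → a < b)) → std (map g t) ≡ std t
std-map-mono g t mono = trans (sym (LP.map-∘ t)) (LP.map-cong-local (All.tabulate λ {a} a∈ →
  cong suc (trans (length-filter-map (_<? g a) g t)
    (length-filter-cong (λ b → g b <? g a) (_<? a) t (λ b b∈ →
      does-⇔ (mk⇔ (proj₂ (mono b∈ a∈)) (proj₁ (mono b∈ a∈))) (g b <? g a) (b <? a))))))

std-idem : ∀ s → std (std s) ≡ std s
std-idem s = std-map-mono (rank s) s (λ a∈ _ → rank-mono-< s a∈ , rank-cancel-< s)

-- Subsequences

∈-subseqs⁻ : ∀ {t} s → t ∈ subseqs s → t ⊆ s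
∈-subseqs⁻ [] (here refl) = []
∈-subseqs⁻ (x ∷ xs) t∈ with ∈-++⁻ (map (x ∷_) (subseqs xs)) t∈
... | inj₂ t∈′ = x ∷ʳ ∈-subseqs⁻ xs t∈′
... | inj₁ t∈′ with ∈-map⁻ (x ∷_) t∈′
... | _ , t′∈ , refl = refl ∷ ∈-subseqs⁻ xs t′∈

∈-subseqs⁺ : ∀ {t s} → t ⊆ s → t ∈ subseqs s
∈-subseqs⁺ [] = here refl
∈-subseqs⁺ (_∷ʳ_ {ys = s} y t⊆s) = ∈-++⁺ʳ (map (y ∷_) (subseqs s)) (∈-subseqs⁺ t⊆s)
∈-subseqs⁺ (refl ∷ t⊆s) = ∈-++⁺ˡ (∈-map⁺ (_ ∷_) (∈-subseqs⁺ t⊆s))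

⊆-∷ʳ⁻ : ∀ {t} u (b : ℕ) → t ⊆ u ++ b ∷ [] → t ⊆ u ⊎ (∃ λ t′ → t ≡ t′ ++ b ∷ [] × t′ ⊆ u)
⊆-∷ʳ⁻ [] b (_ ∷ʳ t⊆[]) = inj₁ t⊆[]
⊆-∷ʳ⁻ [] b (refl ∷ []) = inj₂ ([] , refl , [])
⊆-∷ʳ⁻ (y ∷ u) b (_ ∷ʳ t⊆) with ⊆-∷ʳ⁻ u b t⊆
... | inj₁ t⊆u = inj₁ (y ∷ʳ t⊆u)
... | inj₂ (t′ , eq , t′⊆u) = inj₂ (t′ , eq , y ∷ʳ t′⊆u)
⊆-∷ʳ⁻ (y ∷ u) b (refl ∷ t⊆) with ⊆-∷ʳ⁻ u b t⊆
... | inj₁ t⊆u = inj₁ (refl ∷ t⊆u)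
... | inj₂ (t′ , refl , t′⊆u) = inj₂ (y ∷ t′ , refl , refl ∷ t′⊆u)

⊆-∷ʳ-cancel : ∀ a (c b : ℕ) {u} → a ++ c ∷ [] ⊆ u ++ b ∷ [] → a ⊆ u
⊆-∷ʳ-cancel a c b {u} a∷c⊆ with ⊆-∷ʳ⁻ u b a∷c⊆
... | inj₁ a∷c⊆u = ⊆-trans (⊆P.++ʳ (c ∷ []) ⊆-refl) a∷c⊆u
... | inj₂ (t′ , eq , t′⊆u) = subst (_⊆ u) (sym (proj₁ (LP.∷ʳ-injective a t′ eq))) t′⊆u

⊆-prefix : ∀ a b {u} → a ++ b ⊆ u → a ⊆ u
⊆-prefix a b = ⊆-trans (⊆P.++ʳ b ⊆-refl)

AllPairs-resp-⊆ : ∀ {R : ℕ → ℕ → Set} {t s} → t ⊆ s → AllPairs R s → AllPairs R t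
AllPairs-resp-⊆ [] [] = []
AllPairs-resp-⊆ (_ ∷ʳ t⊆s) (_ ∷ rs) = AllPairs-resp-⊆ t⊆s rs
AllPairs-resp-⊆ (refl ∷ t⊆s) (r ∷ rs) = All-resp-⊆ t⊆s r ∷ AllPairs-resp-⊆ t⊆s rs

AllPairs-last : ∀ {R : ℕ → ℕ → Set} ys z → AllPairs R (ys ++ z ∷ []) → All (λ y → R y z) ys
AllPairs-last [] z _ = []
AllPairs-last (y ∷ ys) z (r ∷ rs) = All.head (AllP.++⁻ʳ ys r) ∷ AllPairs-last ys z rs

subseqs-map : (g : ℕ → ℕ) (s : List ℕ) → subseqs (map g s) ≡ map (map g) (subseqs s)
subseqs-map g [] = refl
subseqs-map g (x ∷ xs) rewrite subseqs-map g xs =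
  trans (cong (_++ _) (trans (sym (LP.map-∘ (subseqs xs))) (LP.map-∘ (subseqs xs))))
        (sym (LP.map-++ (map g) (map (x ∷_) (subseqs xs)) (subseqs xs)))

E-std : ∀ σ s → E σ (std s) ≡ E σ s
E-std σ s = begin
  length (filter (λ u → std u ≟ₗ std σ) (subseqs (map (rank s) s)))
    ≡⟨ cong (length ∘ filter (λ u → std u ≟ₗ std σ)) (subseqs-map (rank s) s) ⟩
  length (filter (λ u → std u ≟ₗ std σ) (map (map (rank s)) (subseqs s)))
    ≡⟨ length-filter-map (λ u → std u ≟ₗ std σ) (map (rank s)) (subseqs s) ⟩
  length (filter (λ u → std (map (rank s) u) ≟ₗ std σ) (subseqs s))
    ≡⟨ length-filter-cong _ _ (subseqs s) (λ t t∈ → cong (λ v → does (v ≟ₗ std σ)) (std-rank t t∈)) ⟩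
  length (filter (λ u → std u ≟ₗ std σ) (subseqs s)) ∎
  where
  open ≡-Reasoning
  std-rank : ∀ t → t ∈ subseqs s → std (map (rank s) t) ≡ std t
  std-rank t t∈ = std-map-mono (rank s) t (λ a∈ _ → rank-mono-< s (lookup (∈-subseqs⁻ s t∈) a∈) , rank-cancel-< s)

leq-std : ∀ σ s → leq σ (std s) ≡ leq σ s
leq-std σ s = cong (λ e → ⌊ 0 <? e ⌋) (E-std σ s)

-- The interval sum

χ : List ℕ → List ℕ → ℤ
χ σ s = [ leq σ s ]· sign (length s)

intervalSum≡∑χ : ∀ σ π →
  sumℤ (map (λ τ → sign (length τ) *ℤ (+ E τ π)) (interval σ π))
    ≡ ∑ (χ σ) (subseqs π)
intervalSum≡∑χ σ π = begin
  ∑ (λ τ → sign (length τ) *ℤ + E τ π) (filter (λ τ → T? (leq σ τ)) D)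
    ≡⟨ ∑-filter (λ τ → T? (leq σ τ)) _ D ⟩
  ∑ (λ τ → [ leq σ τ ]· (sign (length τ) *ℤ + E τ π)) D
    ≡⟨ ∑-cong D (λ τ τ∈ → trans ([]·-* (leq σ τ) _ _) (cong (h τ *ℤ_) (E-fibre τ τ∈))) ⟩
  ∑ (λ τ → h τ *ℤ + length (filter (λ s → std s ≟ₗ τ) S)) D
    ≡⟨ ∑-fibres std h D (deduplicate-! (map std S)) S
         (λ s s∈ → AnyP.deduplicate⁺ _≟ₗ_ (λ e e′ → trans e′ (sym e)) (∈-map⁺ std s∈)) ⟩
  ∑ (h ∘ std) S
    ≡⟨ ∑-cong S (λ s _ → cong₂ (λ b l → [ b ]· sign l) (leq-std σ s) (LP.length-map (rank s) s)) ⟩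
  ∑ (λ s → [ leq σ s ]· sign (length s)) S ∎
  where
  open ≡-Reasoning
  S : List (List ℕ)
  S = subseqs π
  D : List (List ℕ)
  D = deduplicate _≟ₗ_ (map std S)
  h : List ℕ → ℤ
  h τ = [ leq σ τ ]· sign (length τ)
  E-fibre : ∀ τ → τ ∈ D → + E τ π ≡ + length (filter (λ s → std s ≟ₗ τ) S)
  E-fibre τ τ∈ with ∈-map⁻ std (AnyP.deduplicate⁻ _≟ₗ_ τ∈)
  ... | s₀ , _ , refl = cong (λ v → + length (filter (λ s → std s ≟ₗ v) S)) (std-idem s₀)

_occursIn_ : (List ℕ → Set) → List ℕ → Set
Shaped occursIn s = ∃ λ t → t ⊆ s × Shaped t

leq⇔occursIn : ∀ σ s → leq σ s ≡ true ⇔ (λ t → std t ≡ std σ) occursIn s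
leq⇔occursIn σ s = mk⇔ to from
  where
  matches? : (u : List ℕ) → Dec (std u ≡ std σ)
  matches? u = std u ≟ₗ std σ
  to : leq σ s ≡ true → (λ t → std t ≡ std σ) occursIn s
  to eq with 0 <? E σ s
  ... | yes positive with find (filter-nonempty matches? (subseqs s) positive)
  ...   | t , t∈ , std-t = t , ∈-subseqs⁻ s t∈ , std-t
  to () | no _
  from : (λ t → std t ≡ std σ) occursIn s → leq σ s ≡ true
  from (t , t⊆s , std-t) with 0 <? E σ s
  ... | yes _ = refl
  ... | no ¬positive = ⊥-elim (¬positive (LP.filter-some matches? (lose (∈-subseqs⁺ t⊆s) std-t)))

std-framed : ∀ x ys z {a bs c} → let t = x ∷ ys ++ z ∷ [] in
  rank t x ≡ a → map (rank t) ys ≡ bs → rank t z ≡ c → std t ≡ a ∷ bs ++ c ∷ []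
std-framed x ys z rx rys rz = cong₂ _∷_ rx (trans (LP.map-++ _ ys (z ∷ [])) (cong₂ _++_ rys (cong (_∷ []) rz)))

std-framed⁻ : ∀ t {a bs c} → std t ≡ a ∷ bs ++ c ∷ [] →
  ∃ λ x → ∃ λ ys → ∃ λ z → t ≡ x ∷ ys ++ z ∷ [] × rank t x ≡ a × map (rank t) ys ≡ bs × rank t z ≡ c
std-framed⁻ (x ∷ t′) {a} {bs} {c} eq with map-++⁻ (rank (x ∷ t′)) t′ bs (c ∷ []) (LP.∷-injectiveʳ eq)
... | ys , z ∷ [] , refl , rys , rz = x , ys , z , refl , LP.∷-injectiveˡ eq , rys , LP.∷-injectiveˡ rz

-- Cups and caps

record Framed (Inner : ℕ → ℕ → ℕ → Set) (k : ℕ) (t : List ℕ) : Set where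
  constructor framed
  field
    first : ℕ
    middle : List ℕ
    last : ℕ
    shape : t ≡ first ∷ middle ++ last ∷ []
    length-middle : length middle ≡ k
    middle-increasing : AllPairs _<_ middle
    middle-inner : All (Inner first last) middle
    first<last : first < last

CupShaped CapShaped : ℕ → List ℕ → Set
CupShaped = Framed (λ x z y → y < x)
CapShaped = Framed (λ x z y → z < y)

module _ (f : ℕ → ℕ) (k : ℕ) where

  length-map-upTo : length (map f (upTo k)) ≡ k
  length-map-upTo = trans (LP.length-map f (upTo k)) (LP.length-upTo k)

  map-upTo-increasing : (∀ {i j} → i < j → f i < f j) → AllPairs _<_ (map f (upTo k))
  map-upTo-increasing f-mono rewrite LP.map-applyUpTo (λ i → i) f k =
    AllPairsP.applyUpTo⁺₁ f k (λ i<j _ → f-mono i<j)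

  map-upTo-all : {P : ℕ → Set} → (∀ {i} → i < k → P (f i)) → All P (map f (upTo k))
  map-upTo-all Pf rewrite LP.map-applyUpTo (λ i → i) f k = AllP.applyUpTo⁺₁ f k Pf

cup-cupShaped : ∀ k → CupShaped k (cup (2 + k))
cup-cupShaped k = framed (suc k) (map suc (upTo k)) (2 + k) refl (length-map-upTo suc k)
  (map-upTo-increasing suc k s≤s) (map-upTo-all suc k s≤s) (ℕP.n<1+n (suc k))

cap-capShaped : ∀ k → CapShaped k (cap (2 + k))
cap-capShaped k = framed 1 (map (_+ 3) (upTo k)) 2 refl (length-map-upTo (_+ 3) k)
  (map-upTo-increasing (_+ 3) k (ℕP.+-monoˡ-< 3)) (map-upTo-all (_+ 3) k (λ {i} _ → ℕP.m≤n+m 3 i)) (s≤s (s≤s z≤n))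

std-cupShaped : ∀ {k t} → CupShaped k t → std t ≡ cup (2 + k)
std-cupShaped (framed x ys z refl refl increasing ys<x x<z) = std-framed x ys z rank-first ranks-middle rank-last
  where
  open ≡-Reasoning
  t : List ℕ
  t = x ∷ ys ++ z ∷ []
  rank-first : rank t x ≡ suc (length ys)
  rank-first = cong suc (trans (countBelow-framed x x ys z)
    (cong₂ _+_ (countBelow-[≮] {x} (ℕP.<-irrefl refl))
      (trans (cong₂ _+_ (countBelow-all ys<x) (countBelow-[≮] (ℕP.<-asym x<z))) (ℕP.+-identityʳ _))))
  rank-middle : ∀ {y} → y < x → rank t y ≡ suc (countBelow y ys)
  rank-middle {y} y<x = cong suc (trans (countBelow-framed y x ys z)
    (trans (cong₂ _+_ (countBelow-[≮] (ℕP.<-asym y<x))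
             (cong (_+_ (countBelow y ys)) (countBelow-[≮] (ℕP.<-asym (ℕP.<-trans y<x x<z)))))
      (ℕP.+-identityʳ _)))
  ranks-middle : map (rank t) ys ≡ map suc (upTo (length ys))
  ranks-middle = begin
    map (rank t) ys                          ≡⟨ LP.map-cong-local (All.map rank-middle ys<x) ⟩
    map (λ y → suc (countBelow y ys)) ys     ≡⟨ LP.map-∘ ys ⟩
    map suc (map (λ y → countBelow y ys) ys) ≡⟨ cong (map suc) (countBelow-increasing ys increasing) ⟩
    map suc (upTo (length ys))               ∎
  rank-last : rank t z ≡ 2 + length ys
  rank-last = cong suc (trans (countBelow-framed z x ys z)
    (cong₂ _+_ (countBelow-[<] x<z)
      (trans (cong₂ _+_ (countBelow-all (All.map (λ y<x → ℕP.<-trans y<x x<z) ys<x))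
                        (countBelow-[≮] {z} (ℕP.<-irrefl refl)))
        (ℕP.+-identityʳ _))))

std-capShaped : ∀ {k t} → CapShaped k t → std t ≡ cap (2 + k)
std-capShaped (framed x ys z refl refl increasing z<ys x<z) = std-framed x ys z rank-first ranks-middle rank-last
  where
  open ≡-Reasoning
  t : List ℕ
  t = x ∷ ys ++ z ∷ []
  rank-first : rank t x ≡ 1
  rank-first = cong suc (trans (countBelow-framed x x ys z)
    (cong₂ _+_ (countBelow-[≮] {x} (ℕP.<-irrefl refl))
      (cong₂ _+_ (countBelow-none (All.map (λ z<y y<x → ℕP.<-asym (ℕP.<-trans x<z z<y) y<x) z<ys))
                   (countBelow-[≮] (ℕP.<-asym x<z)))))
  rank-middle : ∀ {y} → z < y → rank t y ≡ countBelow y ys + 3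
  rank-middle {y} z<y = trans (cong suc (trans (countBelow-framed y x ys z)
    (cong₂ _+_ (countBelow-[<] (ℕP.<-trans x<z z<y)) (cong (_+_ (countBelow y ys)) (countBelow-[<] z<y)))))
    (trans (cong (_+_ 2) (ℕP.+-comm (countBelow y ys) 1)) (ℕP.+-comm 3 (countBelow y ys)))
  ranks-middle : map (rank t) ys ≡ map (_+ 3) (upTo (length ys))
  ranks-middle = begin
    map (rank t) ys                             ≡⟨ LP.map-cong-local (All.map rank-middle z<ys) ⟩
    map (λ y → countBelow y ys + 3) ys          ≡⟨ LP.map-∘ ys ⟩
    map (_+ 3) (map (λ y → countBelow y ys) ys) ≡⟨ cong (map (_+ 3)) (countBelow-increasing ys increasing) ⟩
    map (_+ 3) (upTo (length ys))               ∎
  rank-last : rank t z ≡ 2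
  rank-last = cong suc (trans (countBelow-framed z x ys z)
    (cong₂ _+_ (countBelow-[<] x<z)
      (cong₂ _+_ (countBelow-none (All.map (λ z<y y<z → ℕP.<-asym z<y y<z) z<ys))
                 (countBelow-[≮] {z} (ℕP.<-irrefl refl)))))

std≡cup⇒cupShaped : ∀ k t → std t ≡ cup (2 + k) → CupShaped k t
std≡cup⇒cupShaped k t eq with std-framed⁻ t eq
... | x , ys , z , refl , rx , rys , rz = framed x ys z refl
  (trans (sym (LP.length-map (rank t) ys)) (trans (cong length rys) (length-map-upTo suc k)))
  (AllPairs.map (rank-cancel-< t) (AllPairsP.map⁻ (subst (AllPairs _<_) (sym rys) (map-upTo-increasing suc k s≤s))))
  (All.map (λ {y} p → rank-cancel-< t (subst (rank t y <_) (sym rx) p))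
     (AllP.map⁻ (subst (All (_< suc k)) (sym rys) (map-upTo-all suc k s≤s))))
  (rank-cancel-< t (subst₂ _<_ (sym rx) (sym rz) (ℕP.n<1+n (suc k))))

std≡cap⇒capShaped : ∀ k t → std t ≡ cap (2 + k) → CapShaped k t
std≡cap⇒capShaped k t eq with std-framed⁻ t eq
... | x , ys , z , refl , rx , rys , rz = framed x ys z refl
  (trans (sym (LP.length-map (rank t) ys)) (trans (cong length rys) (length-map-upTo (_+ 3) k)))
  (AllPairs.map (rank-cancel-< t) (AllPairsP.map⁻ (subst (AllPairs _<_) (sym rys) (map-upTo-increasing (_+ 3) k (ℕP.+-monoˡ-< 3)))))
  (All.map (λ {y} p → rank-cancel-< t (subst (_< rank t y) (sym rz) p))
     (AllP.map⁻ (subst (All (2 <_)) (sym rys) (map-upTo-all (_+ 3) k (λ {i} _ → ℕP.m≤n+m 3 i)))))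
  (rank-cancel-< t (subst₂ _<_ (sym rx) (sym rz) (s≤s (s≤s z≤n))))

leq-cup⇔ : ∀ k s → leq (cup (2 + k)) s ≡ true ⇔ CupShaped k occursIn s
leq-cup⇔ k s = mk⇔
  (λ le → let t , t⊆s , std-t = Equivalence.to (leq⇔occursIn _ s) le in
    t , t⊆s , std≡cup⇒cupShaped k t (trans std-t std-cup))
  (λ (t , t⊆s , shaped) → Equivalence.from (leq⇔occursIn _ s) (t , t⊆s , trans (std-cupShaped shaped) (sym std-cup)))
  where
  std-cup : std (cup (2 + k)) ≡ cup (2 + k)
  std-cup = std-cupShaped (cup-cupShaped k)

leq-cap⇔ : ∀ k s → leq (cap (2 + k)) s ≡ true ⇔ CapShaped k occursIn s
leq-cap⇔ k s = mk⇔
  (λ le → let t , t⊆s , std-t = Equivalence.to (leq⇔occursIn _ s) le in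
    t , t⊆s , std≡cap⇒capShaped k t (trans std-t std-cap))
  (λ (t , t⊆s , shaped) → Equivalence.from (leq⇔occursIn _ s) (t , t⊆s , trans (std-capShaped shaped) (sym std-cap)))
  where
  std-cap : std (cap (2 + k)) ≡ cap (2 + k)
  std-cap = std-capShaped (cap-capShaped k)

-- Words of lows and highs

module Classification (n : ℕ) where

  isLow : ℕ → Bool
  isLow x = does (x ≤? n)

  Low High : ℕ → Set
  Low x = isLow x ≡ true
  High x = isLow x ≡ false

  low⇔≤ : ∀ {x} → Low x ⇔ x ≤ n
  low⇔≤ {x} = mk⇔ (λ eq → ℕP.≤ᵇ⇒≤ x n (subst T (sym eq) _)) (dec-true (x ≤? n))

  high⇔≰ : ∀ {x} → High x ⇔ (¬ x ≤ n)
  high⇔≰ {x} = mk⇔ (λ eq x≤n → subst T eq (ℕP.≤⇒≤ᵇ x≤n)) (dec-false (x ≤? n))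

  low-miss : ∀ {x} → Low x → isLow x ≢ false
  low-miss low eq with () ← trans (sym low) eq

  high-miss : ∀ {x} → High x → isLow x ≢ true
  high-miss high eq with () ← trans (sym high) eq

  -- A word over Bool is a pattern of lows (true) and highs (false); matching is greedy.
  matches : List Bool → List ℕ → Bool
  matches [] u = true
  matches (b ∷ w) [] = false
  matches (b ∷ w) (x ∷ u) = if does (isLow x Bool.≟ b) then matches w u else matches (b ∷ w) u

  matches-hit : ∀ {b x} w u → isLow x ≡ b → matches (b ∷ w) (x ∷ u) ≡ matches w u
  matches-hit {b} {x} w u hit with isLow x Bool.≟ b
  ... | yes _ = refl
  ... | no miss = ⊥-elim (miss hit)

  matches-miss : ∀ {b x} w u → isLow x ≢ b → matches (b ∷ w) (x ∷ u) ≡ matches (b ∷ w) u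
  matches-miss {b} {x} w u miss with isLow x Bool.≟ b
  ... | yes hit = ⊥-elim (miss hit)
  ... | no _ = refl

  matches-∷ʳ : ∀ w x u → matches w u ≡ true → matches w (x ∷ u) ≡ true
  matches-tail : ∀ b w u → matches (b ∷ w) u ≡ true → matches w u ≡ true

  matches-∷ʳ [] x u _ = refl
  matches-∷ʳ (b ∷ w) x u m with isLow x Bool.≟ b
  ... | yes _ = matches-tail b w u m
  ... | no _ = m

  matches-tail b w (x ∷ u) m with isLow x Bool.≟ b
  ... | yes _ = matches-∷ʳ w x u m
  ... | no _ = matches-∷ʳ w x u (matches-tail b w u m)

  matches⇔ : ∀ w u → matches w u ≡ true ⇔ (∃ λ t → t ⊆ u × map isLow t ≡ w)
  matches⇔ w u = mk⇔ (to w u) (λ (t , t⊆u , eq) → subst (λ w → matches w u ≡ true) eq (from t⊆u))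
    where
    to : ∀ w u → matches w u ≡ true → ∃ λ t → t ⊆ u × map isLow t ≡ w
    to [] u _ = [] , minimum u , refl
    to (b ∷ w) (x ∷ u) m with isLow x Bool.≟ b
    ... | yes hit = let t , t⊆u , eq = to w u m in x ∷ t , refl ∷ t⊆u , cong₂ _∷_ hit eq
    ... | no _ = let t , t⊆u , eq = to (b ∷ w) u m in t , x ∷ʳ t⊆u , eq
    from : ∀ {t u} → t ⊆ u → matches (map isLow t) u ≡ true
    from [] = refl
    from {t} {x ∷ u} (x ∷ʳ t⊆u) = matches-∷ʳ (map isLow t) x u (from t⊆u)
    from {x ∷ t} {x ∷ u} (refl ∷ t⊆u) = trans (matches-hit {x = x} (map isLow t) u refl) (from t⊆u)

  matches-replicate⇔ : ∀ b k u →
    matches (replicate k b) u ≡ true ⇔ (∃ λ ys → ys ⊆ u × All (λ y → isLow y ≡ b) ys × length ys ≡ k)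
  matches-replicate⇔ b k u = mk⇔
    (λ m → let ys , ys⊆u , eq = Equivalence.to (matches⇔ _ u) m
           in ys , ys⊆u , Equivalence.to (map≡replicate⇔ isLow b k ys) eq)
    (λ (ys , ys⊆u , ys-b , len) → Equivalence.from (matches⇔ _ u)
      (ys , ys⊆u , Equivalence.from (map≡replicate⇔ isLow b k ys) (ys-b , len)))

  matches-lowsThenHigh⇔ : ∀ k u → matches (replicate k true ++ false ∷ []) u ≡ true ⇔
    (∃ λ ys → ∃ λ h → ys ++ h ∷ [] ⊆ u × All Low ys × length ys ≡ k × High h)
  matches-lowsThenHigh⇔ k u = mk⇔
    (λ m → let t , t⊆u , eq = Equivalence.to (matches⇔ _ u) m in split t t⊆u eq)
    (λ (ys , h , t⊆u , ys-low , len , h-high) → Equivalence.from (matches⇔ _ u)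
      (ys ++ h ∷ [] , t⊆u , trans (LP.map-++ isLow ys (h ∷ []))
        (cong₂ _++_ (Equivalence.from (map≡replicate⇔ isLow true k ys) (ys-low , len)) (cong (_∷ []) h-high))))
    where
    split : ∀ t → t ⊆ u → map isLow t ≡ replicate k true ++ false ∷ [] →
      ∃ λ ys → ∃ λ h → ys ++ h ∷ [] ⊆ u × All Low ys × length ys ≡ k × High h
    split t t⊆u eq with map-++⁻ isLow t (replicate k true) (false ∷ []) eq
    ... | ys , h ∷ [] , refl , eq₁ , eq₂ =
      let ys-low , len = Equivalence.to (map≡replicate⇔ isLow true k ys) eq₁
      in ys , h , t⊆u , ys-low , len , LP.∷-injectiveˡ eq₂

  matches-lowThenHighs⇔ : ∀ k u → matches (true ∷ replicate k false) u ≡ true ⇔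
    (∃ λ l → ∃ λ hs → l ∷ hs ⊆ u × Low l × All High hs × length hs ≡ k)
  matches-lowThenHighs⇔ k u = mk⇔
    (λ m → let t , t⊆u , eq = Equivalence.to (matches⇔ _ u) m in split t t⊆u eq)
    (λ (l , hs , t⊆u , l-low , hs-high , len) → Equivalence.from (matches⇔ _ u)
      (l ∷ hs , t⊆u , cong₂ _∷_ l-low (Equivalence.from (map≡replicate⇔ isLow false k hs) (hs-high , len))))
    where
    split : ∀ t → t ⊆ u → map isLow t ≡ true ∷ replicate k false →
      ∃ λ l → ∃ λ hs → l ∷ hs ⊆ u × Low l × All High hs × length hs ≡ k
    split (l ∷ hs) t⊆u eq =
      let hs-high , len = Equivalence.to (map≡replicate⇔ isLow false k hs) (LP.∷-injectiveʳ eq)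
      in l , hs , t⊆u , LP.∷-injectiveˡ eq , hs-high , len

-- The permutation πₙ

module PiStructure (n : ℕ) where

  open Classification n public

  A B : ℕ
  A = suc n
  B = n + 2

  pair : ℕ → List ℕ
  pair i = i ∷ B + i ∷ []

  -- πₙ n is A ∷ Mid ++ B ∷ [] by definition.
  Mid : List ℕ
  Mid = concatMap pair (map suc (upTo n))

  LowOrAboveB : ℕ → Set
  LowOrAboveB x = Low x ⊎ B < x

  InOrder : ℕ → ℕ → Set
  InOrder x y = x < y ⊎ (Low y × B < x)

  A<B : A < B
  A<B = subst (A <_) (ℕP.+-comm 2 n) (ℕP.n<1+n A)

  low-high-absurd : ∀ {x} → Low x → High x → ⊥
  low-high-absurd low high with () ← trans (sym low) high

  <A⇒low : ∀ {y} → y < A → Low y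
  <A⇒low y<A = Equivalence.from low⇔≤ (ℕP.≤-pred y<A)

  A<⇒high : ∀ {y} → A < y → High y
  A<⇒high A<y = Equivalence.from high⇔≰ (λ y≤n → ℕP.<-irrefl refl (ℕP.<-≤-trans (ℕP.<-trans (ℕP.n<1+n n) A<y) y≤n))

  B<⇒high : ∀ {y} → B < y → High y
  B<⇒high B<y = A<⇒high (ℕP.<-trans A<B B<y)

  low<B : ∀ {y} → Low y → y < B
  low<B low = ℕP.≤-<-trans (Equivalence.to low⇔≤ low) (ℕP.m<m+n n (s≤s z≤n))

  aboveB : ∀ {y} → LowOrAboveB y → High y → B < y
  aboveB {y} (inj₁ low) high = ⊥-elim (low-high-absurd {y} low high)
  aboveB (inj₂ B<y) _ = B<y

  descent⇒low : ∀ {x y} → InOrder x y → y < x → Low y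
  descent⇒low (inj₁ x<y) y<x = ⊥-elim (ℕP.<-asym x<y y<x)
  descent⇒low (inj₂ (low , _)) _ = low

  descent⇒aboveB : ∀ {x y} → InOrder x y → y < x → B < x
  descent⇒aboveB (inj₁ x<y) y<x = ⊥-elim (ℕP.<-asym x<y y<x)
  descent⇒aboveB (inj₂ (_ , B<x)) _ = B<x

  increasing-lows : ∀ {ys} → AllPairs InOrder ys → All Low ys → AllPairs _<_ ys
  increasing-lows [] [] = []
  increasing-lows {x ∷ _} (rs ∷ ordered) (low ∷ lows) = All.map ascent rs ∷ increasing-lows ordered lows
    where
    ascent : ∀ {y} → InOrder x y → x < y
    ascent (inj₁ x<y) = x<y
    ascent (inj₂ (_ , B<x)) = ⊥-elim (low-high-absurd {x} low (B<⇒high B<x))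

  increasing-highs : ∀ {ys} → AllPairs InOrder ys → All High ys → AllPairs _<_ ys
  increasing-highs [] [] = []
  increasing-highs (rs ∷ ordered) (_ ∷ highs) = All.zipWith ascent (rs , highs) ∷ increasing-highs ordered highs
    where
    ascent : ∀ {x y} → InOrder x y × High y → x < y
    ascent (inj₁ x<y , _) = x<y
    ascent {y = y} (inj₂ (low , _) , high) = ⊥-elim (low-high-absurd {y} low high)

  InRange : ℕ → Set
  InRange i = 1 ≤ i × i ≤ n

  pairs-lowOrAboveB : ∀ is → All InRange is → All LowOrAboveB (concatMap pair is)
  pairs-lowOrAboveB is inRange = AllP.concat⁺ (AllP.map⁺ (All.map
    (λ (1≤i , i≤n) → inj₁ (Equivalence.from low⇔≤ i≤n) ∷ inj₂ (ℕP.m<m+n B 1≤i) ∷ []) inRange))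

  pairs-inOrder : ∀ is → AllPairs _<_ is → All InRange is → AllPairs InOrder (concatMap pair is)
  pairs-inOrder [] [] [] = []
  pairs-inOrder (i ∷ is) (i<is ∷ increasing) ((1≤i , _) ∷ inRange) =
    (inj₁ (ℕP.m<n+m i (ℕP.≤-trans (s≤s z≤n) A<B)) ∷ AllP.concat⁺ (AllP.map⁺ (All.map i-before i<is)))
    ∷ AllP.concat⁺ (AllP.map⁺ (All.zipWith partner-before (i<is , inRange)))
    ∷ pairs-inOrder is increasing inRange
    where
    i-before : ∀ {j} → i < j → All (InOrder i) (pair j)
    i-before {j} i<j = inj₁ i<j ∷ inj₁ (ℕP.<-≤-trans i<j (ℕP.m≤n+m j B)) ∷ []
    partner-before : ∀ {j} → i < j × InRange j → All (InOrder (B + i)) (pair j)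
    partner-before (i<j , (_ , j≤n)) = inj₂ (Equivalence.from low⇔≤ j≤n , ℕP.m<m+n B 1≤i) ∷ inj₁ (ℕP.+-monoʳ-< B i<j) ∷ []

  indices-inRange : All InRange (map suc (upTo n))
  indices-inRange = map-upTo-all suc n (λ i<n → s≤s z≤n , i<n)

  Mid-lowOrAboveB : All LowOrAboveB Mid
  Mid-lowOrAboveB = pairs-lowOrAboveB _ indices-inRange

  Mid-inOrder : AllPairs InOrder Mid
  Mid-inOrder = pairs-inOrder _ (map-upTo-increasing suc n s≤s) indices-inRange

  module _ (k : ℕ) (u : List ℕ) (ordered : AllPairs InOrder u) where

    -- An occurrence ending at B would start above B: its first entry precedes a smaller one in u.
    cup-dropB : CupShaped (suc k) occursIn (u ++ B ∷ []) → CupShaped (suc k) occursIn u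
    cup-dropB (_ , t⊆ , framed x [] z refl () _ _ _)
    cup-dropB (_ , t⊆ , shaped@(framed x (y ∷ ys) z refl len _ (y<x ∷ _) x<z)) with ⊆-∷ʳ⁻ u B t⊆
    ... | inj₁ t⊆u = _ , t⊆u , shaped
    ... | inj₂ (t′ , eq , t′⊆u) with LP.∷ʳ-injective (x ∷ y ∷ ys) t′ eq
    ...   | refl , refl with AllPairs-resp-⊆ t′⊆u ordered
    ...     | x-before ∷ _ = ⊥-elim (ℕP.<-asym (descent⇒aboveB (All.head x-before) y<x) x<z)

    cup-framedByAB⇒ : CupShaped (suc k) occursIn (A ∷ u ++ B ∷ []) → matches (replicate (suc k) true) u ≡ true
    cup-framedByAB⇒ (_ , refl ∷ t⊆ , framed x ys z refl len _ ys<x _) = Equivalence.from (matches-replicate⇔ true _ u)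
      (ys , ⊆-∷ʳ-cancel ys z B t⊆ , All.map <A⇒low ys<x , len)
    cup-framedByAB⇒ (_ , _ ∷ʳ t⊆ , framed x ys z refl len _ ys<x _) with ⊆-∷ʳ-cancel (x ∷ ys) z B t⊆
    ... | x∷ys⊆u with AllPairs-resp-⊆ x∷ys⊆u ordered
    ...   | x-before ∷ _ = Equivalence.from (matches-replicate⇔ true _ u)
      (ys , ⊆P.∷ˡ⁻ x∷ys⊆u , All.zipWith (λ (r , y<x) → descent⇒low r y<x) (x-before , ys<x) , len)

    cup-framedByA⇒ : CupShaped (suc k) occursIn (A ∷ u) → matches (replicate (suc k) true ++ false ∷ []) u ≡ true
    cup-framedByA⇒ (_ , refl ∷ t⊆u , framed x ys z refl len _ ys<x x<z) = Equivalence.from (matches-lowsThenHigh⇔ _ u)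
      (ys , z , t⊆u , All.map <A⇒low ys<x , len , A<⇒high x<z)
    cup-framedByA⇒ (_ , _ ∷ʳ t⊆u , framed x [] z refl () _ _ _)
    cup-framedByA⇒ (_ , _ ∷ʳ t⊆u , framed x (y ∷ ys) z refl len _ ys<x@(y<x ∷ _) x<z) with AllPairs-resp-⊆ t⊆u ordered
    ... | x-before ∷ _ = Equivalence.from (matches-lowsThenHigh⇔ _ u)
      (y ∷ ys , z , ⊆P.∷ˡ⁻ t⊆u ,
       All.zipWith (λ (r , y<x) → descent⇒low r y<x) (AllP.++⁻ˡ (y ∷ ys) x-before , ys<x) , len ,
       B<⇒high (ℕP.<-trans (descent⇒aboveB (All.head x-before) y<x) x<z))

    -- An occurrence starting at A would end at a low entry: its last entry follows a larger one in u.
    cap-dropA : CapShaped (suc k) occursIn (A ∷ u) → CapShaped (suc k) occursIn u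
    cap-dropA (_ , _ ∷ʳ t⊆u , shaped) = _ , t⊆u , shaped
    cap-dropA (_ , refl ∷ t⊆u , framed x [] z refl () _ _ _)
    cap-dropA (_ , refl ∷ t⊆u , framed x (y ∷ ys) z refl len _ (z<y ∷ _) x<z)
      with AllPairs-last (y ∷ ys) z (AllPairs-resp-⊆ t⊆u ordered)
    ... | y-before-z ∷ _ = ⊥-elim (low-high-absurd {z} (descent⇒low y-before-z z<y) (A<⇒high x<z))

    cap-framedByAB⇒ : CapShaped (suc k) occursIn (A ∷ u ++ B ∷ []) → matches (replicate (suc k) false) u ≡ true
    cap-framedByAB⇒ (_ , refl ∷ t⊆ , framed x ys z refl len _ z<ys x<z) = Equivalence.from (matches-replicate⇔ false _ u)
      (ys , ⊆-∷ʳ-cancel ys z B t⊆ , All.map (λ z<y → A<⇒high (ℕP.<-trans x<z z<y)) z<ys , len)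
    cap-framedByAB⇒ (_ , _ ∷ʳ t⊆ , framed x ys z refl len _ z<ys x<z) with ⊆-∷ʳ⁻ u B t⊆
    ... | inj₁ t⊆u = Equivalence.from (matches-replicate⇔ false _ u)
      (ys , ⊆-prefix ys (z ∷ []) (⊆P.∷ˡ⁻ t⊆u) ,
       All.zipWith (λ (r , z<y) → B<⇒high (descent⇒aboveB r z<y))
         (AllPairs-last ys z (AllPairs-resp-⊆ (⊆P.∷ˡ⁻ t⊆u) ordered) , z<ys) ,
       len)
    ... | inj₂ (t′ , eq , t′⊆u) with LP.∷ʳ-injective (x ∷ ys) t′ eq
    ...   | refl , refl = Equivalence.from (matches-replicate⇔ false _ u) (ys , ⊆P.∷ˡ⁻ t′⊆u , All.map B<⇒high z<ys , len)

    module _ (lowOrAboveB : All LowOrAboveB u) where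

      cup-framedByAB⇐ : matches (replicate (suc k) true) u ≡ true → CupShaped (suc k) occursIn (A ∷ u ++ B ∷ [])
      cup-framedByAB⇐ m with Equivalence.to (matches-replicate⇔ true _ u) m
      ... | ys , ys⊆u , lows , len = _ , refl ∷ ⊆P.++⁺ ys⊆u ⊆-refl ,
        framed A ys B refl len (increasing-lows (AllPairs-resp-⊆ ys⊆u ordered) lows)
          (All.map (s≤s ∘ Equivalence.to low⇔≤) lows) A<B

      cup-framedByA⇐ : matches (replicate (suc k) true ++ false ∷ []) u ≡ true → CupShaped (suc k) occursIn (A ∷ u)
      cup-framedByA⇐ m with Equivalence.to (matches-lowsThenHigh⇔ _ u) m
      ... | ys , h , t⊆u , lows , len , high = _ , refl ∷ t⊆u ,
        framed A ys h refl len (increasing-lows (AllPairs-resp-⊆ (⊆-prefix ys (h ∷ []) t⊆u) ordered) lows)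
          (All.map (s≤s ∘ Equivalence.to low⇔≤) lows)
          (ℕP.<-trans A<B (aboveB (All.lookup lowOrAboveB (lookup t⊆u (∈-++⁺ʳ ys (here refl)))) high))

      cap-framedByAB⇐ : matches (replicate (suc k) false) u ≡ true → CapShaped (suc k) occursIn (A ∷ u ++ B ∷ [])
      cap-framedByAB⇐ m with Equivalence.to (matches-replicate⇔ false _ u) m
      ... | hs , hs⊆u , highs , len = _ , refl ∷ ⊆P.++⁺ hs⊆u ⊆-refl ,
        framed A hs B refl len (increasing-highs (AllPairs-resp-⊆ hs⊆u ordered) highs)
          (All.zipWith (λ (l , h) → aboveB l h) (All-resp-⊆ hs⊆u lowOrAboveB , highs)) A<B

      cap-framedByB⇒ : CapShaped (suc k) occursIn (u ++ B ∷ []) → matches (true ∷ replicate (suc k) false) u ≡ true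
      cap-framedByB⇒ (_ , t⊆ , framed x [] z refl () _ _ _)
      cap-framedByB⇒ (_ , t⊆ , framed x (y ∷ ys) z refl len _ z<ys x<z) with ⊆-∷ʳ⁻ u B t⊆
      ... | inj₁ t⊆u with AllPairs-last (y ∷ ys) z (AllPairs-resp-⊆ (⊆P.∷ˡ⁻ t⊆u) ordered)
      ...   | y-before-z ∷ rest = Equivalence.from (matches-lowThenHighs⇔ _ u)
        (x , y ∷ ys , ⊆-prefix (x ∷ y ∷ ys) (z ∷ []) t⊆u ,
         Equivalence.from low⇔≤
           (ℕP.≤-trans (ℕP.<⇒≤ x<z) (Equivalence.to low⇔≤ (descent⇒low y-before-z (All.head z<ys)))) ,
         All.zipWith (λ (r , z<y) → B<⇒high (descent⇒aboveB r z<y)) (y-before-z ∷ rest , z<ys) , len)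
      cap-framedByB⇒ (_ , t⊆ , framed x (y ∷ ys) z refl len _ z<ys x<z) | inj₂ (t′ , eq , t′⊆u)
        with LP.∷ʳ-injective (x ∷ y ∷ ys) t′ eq
      ... | refl , refl with All.lookup lowOrAboveB (lookup t′⊆u (here refl))
      ...   | inj₂ B<x = ⊥-elim (ℕP.<-asym B<x x<z)
      ...   | inj₁ low = Equivalence.from (matches-lowThenHighs⇔ _ u) (x , y ∷ ys , t′⊆u , low , All.map B<⇒high z<ys , len)

      cap-framedByB⇐ : matches (true ∷ replicate (suc k) false) u ≡ true → CapShaped (suc k) occursIn (u ++ B ∷ [])
      cap-framedByB⇐ m with Equivalence.to (matches-lowThenHighs⇔ _ u) m
      ... | l , hs , t⊆u , low , highs , len = _ , ⊆P.++⁺ t⊆u ⊆-refl ,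
        framed l hs B refl len (increasing-highs (AllPairs-resp-⊆ (⊆P.∷ˡ⁻ t⊆u) ordered) highs)
          (All.zipWith (λ (l , h) → aboveB l h) (All-resp-⊆ (⊆P.∷ˡ⁻ t⊆u) lowOrAboveB , highs)) (low<B low)

-- Alternating sums

∑-subseqs-∷ : (g : List ℕ → ℤ) (x : ℕ) (xs : List ℕ) →
  ∑ g (subseqs (x ∷ xs)) ≡ ∑ (λ u → g (x ∷ u) +ℤ g u) (subseqs xs)
∑-subseqs-∷ g x xs = begin
  ∑ g (map (x ∷_) (subseqs xs) ++ subseqs xs)       ≡⟨ ∑-++ g (map (x ∷_) (subseqs xs)) (subseqs xs) ⟩
  ∑ g (map (x ∷_) (subseqs xs)) +ℤ ∑ g (subseqs xs)  ≡⟨ cong (_+ℤ ∑ g (subseqs xs)) (∑-map g (x ∷_) (subseqs xs)) ⟩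
  ∑ (g ∘ (x ∷_)) (subseqs xs) +ℤ ∑ g (subseqs xs)    ≡⟨ sym (∑-+ (g ∘ (x ∷_)) g (subseqs xs)) ⟩
  ∑ (λ u → g (x ∷ u) +ℤ g u) (subseqs xs) ∎
  where open ≡-Reasoning

∑-subseqs-∷ʳ : (g : List ℕ → ℤ) (xs : List ℕ) (b : ℕ) →
  ∑ g (subseqs (xs ++ b ∷ [])) ≡ ∑ (λ u → g (u ++ b ∷ []) +ℤ g u) (subseqs xs)
∑-subseqs-∷ʳ g [] b = sym (ℤP.+-assoc (g (b ∷ [])) (g []) (+ 0))
∑-subseqs-∷ʳ g (x ∷ xs) b = begin
  ∑ g (subseqs (x ∷ xs ++ b ∷ []))
    ≡⟨ ∑-subseqs-∷ g x (xs ++ b ∷ []) ⟩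
  ∑ (λ u → g (x ∷ u) +ℤ g u) (subseqs (xs ++ b ∷ []))
    ≡⟨ ∑-subseqs-∷ʳ (λ u → g (x ∷ u) +ℤ g u) xs b ⟩
  ∑ (λ u → (g (x ∷ u ++ b ∷ []) +ℤ g (u ++ b ∷ [])) +ℤ (g (x ∷ u) +ℤ g u)) (subseqs xs)
    ≡⟨ ∑-cong (subseqs xs) (λ u _ → interchange (g (x ∷ u ++ b ∷ [])) (g (u ++ b ∷ [])) (g (x ∷ u)) (g u)) ⟩
  ∑ (λ u → (g (x ∷ u ++ b ∷ []) +ℤ g (x ∷ u)) +ℤ (g (u ++ b ∷ []) +ℤ g u)) (subseqs xs)
    ≡⟨ sym (∑-subseqs-∷ (λ u → g (u ++ b ∷ []) +ℤ g u) x xs) ⟩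
  ∑ (λ u → g (u ++ b ∷ []) +ℤ g u) (subseqs (x ∷ xs)) ∎
  where
  open ≡-Reasoning
  interchange : ∀ a b c d → (a +ℤ b) +ℤ (c +ℤ d) ≡ (a +ℤ c) +ℤ (b +ℤ d)
  interchange = solve-∀

alternatingSum : (List ℕ → Bool) → List ℕ → ℤ
alternatingSum P L = ∑ (λ u → [ P u ]· sign (length u)) (subseqs L)

alternatingSum-cong : ∀ {P Q} L → (∀ u → P u ≡ Q u) → alternatingSum P L ≡ alternatingSum Q L
alternatingSum-cong L P≗Q = ∑-cong (subseqs L) (λ u _ → cong (λ b → [ b ]· sign (length u)) (P≗Q u))

alternatingSum-∷ : ∀ P x L → alternatingSum P (x ∷ L) ≡ - alternatingSum (P ∘ (x ∷_)) L +ℤ alternatingSum P L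
alternatingSum-∷ P x L = begin
  alternatingSum P (x ∷ L)
    ≡⟨ ∑-subseqs-∷ _ x L ⟩
  ∑ (λ u → [ P (x ∷ u) ]· (- sign (length u)) +ℤ [ P u ]· sign (length u)) (subseqs L)
    ≡⟨ ∑-+ _ _ (subseqs L) ⟩
  ∑ (λ u → [ P (x ∷ u) ]· (- sign (length u))) (subseqs L) +ℤ alternatingSum P L
    ≡⟨ cong (_+ℤ alternatingSum P L)
         (trans (∑-cong (subseqs L) (λ u _ → []·-neg (P (x ∷ u)) _)) (∑-neg _ (subseqs L))) ⟩
  - alternatingSum (P ∘ (x ∷_)) L +ℤ alternatingSum P L ∎
  where open ≡-Reasoning

-- Pairing u with x ∷ u is a sign-reversing involution when P ignores x.
alternatingSum-free : ∀ P x L → (∀ u → P (x ∷ u) ≡ P u) → alternatingSum P (x ∷ L) ≡ + 0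
alternatingSum-free P x L ignores = begin
  alternatingSum P (x ∷ L)
    ≡⟨ alternatingSum-∷ P x L ⟩
  - alternatingSum (P ∘ (x ∷_)) L +ℤ alternatingSum P L
    ≡⟨ cong (λ s → - s +ℤ alternatingSum P L) (alternatingSum-cong L ignores) ⟩
  - alternatingSum P L +ℤ alternatingSum P L
    ≡⟨ ℤP.+-inverseˡ (alternatingSum P L) ⟩
  + 0 ∎
  where open ≡-Reasoning

module AlternatingMatches (n : ℕ) where

  open Classification n

  lowsHighs : ℕ → ℕ → List Bool
  lowsHighs a b = replicate a true ++ replicate b false

  alternatingSum-miss : ∀ {b} w x L → isLow x ≢ b → alternatingSum (matches (b ∷ w)) (x ∷ L) ≡ + 0
  alternatingSum-miss w x L miss = alternatingSum-free _ x L (λ u → matches-miss {x = x} w u miss)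

  alternatingSum-[] : ∀ x L → alternatingSum (matches []) (x ∷ L) ≡ + 0
  alternatingSum-[] x L = alternatingSum-free _ x L (λ _ → refl)

  alternatingSum-hit : ∀ {b} w x L → isLow x ≡ b →
    alternatingSum (matches w) L ≡ + 0 → alternatingSum (matches (b ∷ w)) L ≡ + 0 →
    alternatingSum (matches (b ∷ w)) (x ∷ L) ≡ + 0
  alternatingSum-hit w x L hit vanishes vanishes′ =
    trans (alternatingSum-∷ _ x L)
      (cong₂ (λ s s′ → - s +ℤ s′) (trans (alternatingSum-cong L (λ u → matches-hit {x = x} w u hit)) vanishes) vanishes′)

  alternatingSum-lowsHighs : ∀ a b x h y rest → Low x → High h → Low y →
    alternatingSum (matches (lowsHighs a b)) (x ∷ h ∷ y ∷ rest) ≡ + 0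
  alternatingSum-lowsHighs zero zero x h y rest _ _ _ = alternatingSum-[] x (h ∷ y ∷ rest)
  alternatingSum-lowsHighs zero (suc b) x h y rest low-x _ _ =
    alternatingSum-miss (replicate b false) x (h ∷ y ∷ rest) (low-miss {x} low-x)
  alternatingSum-lowsHighs (suc zero) b x h y rest low-x high-h low-y =
    alternatingSum-hit (replicate b false) x (h ∷ y ∷ rest) low-x (after-h b)
      (alternatingSum-miss (replicate b false) h (y ∷ rest) (high-miss {h} high-h))
    where
    after-y : ∀ b → alternatingSum (matches (replicate b false)) (y ∷ rest) ≡ + 0
    after-y zero = alternatingSum-[] y rest
    after-y (suc b) = alternatingSum-miss (replicate b false) y rest (low-miss {y} low-y)
    after-h : ∀ b → alternatingSum (matches (replicate b false)) (h ∷ y ∷ rest) ≡ + 0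
    after-h zero = alternatingSum-[] h (y ∷ rest)
    after-h (suc b) = alternatingSum-hit (replicate b false) h (y ∷ rest) high-h (after-y b)
      (alternatingSum-miss (replicate b false) y rest (low-miss {y} low-y))
  alternatingSum-lowsHighs (suc (suc a)) b x h y rest low-x high-h _ =
    alternatingSum-hit (lowsHighs (suc a) b) x (h ∷ y ∷ rest) low-x
      (alternatingSum-miss (lowsHighs a b) h (y ∷ rest) (high-miss {h} high-h))
      (alternatingSum-miss (lowsHighs (suc a) b) h (y ∷ rest) (high-miss {h} high-h))

-- Cancellation over the subsequences of πₙ

sign-∷ʳ : ∀ u (b : ℕ) → sign (length (u ++ b ∷ [])) ≡ - sign (length u)
sign-∷ʳ [] b = refl
sign-∷ʳ (x ∷ u) b = cong -_ (sign-∷ʳ u b)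

module Cancellation (n : ℕ) where

  open PiStructure n

  fourTerms : List ℕ → List ℕ → ℤ
  fourTerms σ u = (χ σ (A ∷ u ++ B ∷ []) +ℤ χ σ (u ++ B ∷ [])) +ℤ (χ σ (A ∷ u) +ℤ χ σ u)

  fourTerms-signs : ∀ σ u → let e = sign (length u) in
    fourTerms σ u ≡ ([ leq σ (A ∷ u ++ B ∷ []) ]· e +ℤ - [ leq σ (u ++ B ∷ []) ]· e)
                 +ℤ (- [ leq σ (A ∷ u) ]· e +ℤ [ leq σ u ]· e)
  fourTerms-signs σ u = cong₂ _+ℤ_
    (cong₂ _+ℤ_ (cong ([ leq σ (A ∷ u ++ B ∷ []) ]·_) (trans (cong -_ (sign-∷ʳ u B)) (ℤP.neg-involutive (sign (length u)))))
                (trans (cong ([ leq σ (u ++ B ∷ []) ]·_) (sign-∷ʳ u B)) ([]·-neg (leq σ (u ++ B ∷ [])) (sign (length u)))))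
    (cong (_+ℤ χ σ u) ([]·-neg (leq σ (A ∷ u)) (sign (length u))))

  ∑χ-cancellation : ∀ σ (P Q : List ℕ → Bool) →
    (∀ u → u ⊆ Mid → fourTerms σ u ≡ [ P u ]· sign (length u) +ℤ - [ Q u ]· sign (length u)) →
    alternatingSum P Mid ≡ + 0 → alternatingSum Q Mid ≡ + 0 →
    ∑ (χ σ) (subseqs (πₙ n)) ≡ + 0
  ∑χ-cancellation σ P Q four-terms P-vanishes Q-vanishes = begin
    ∑ (χ σ) (subseqs (A ∷ Mid ++ B ∷ []))
      ≡⟨ trans (∑-subseqs-∷ (χ σ) A (Mid ++ B ∷ [])) (∑-subseqs-∷ʳ _ Mid B) ⟩
    ∑ (fourTerms σ) (subseqs Mid)
      ≡⟨ ∑-cong (subseqs Mid) (λ u u∈ → four-terms u (∈-subseqs⁻ Mid u∈)) ⟩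
    ∑ (λ u → [ P u ]· sign (length u) +ℤ - [ Q u ]· sign (length u)) (subseqs Mid)
      ≡⟨ trans (∑-+ _ _ (subseqs Mid)) (cong (alternatingSum P Mid +ℤ_) (∑-neg _ (subseqs Mid))) ⟩
    alternatingSum P Mid +ℤ - alternatingSum Q Mid
      ≡⟨ cong₂ (λ p q → p +ℤ - q) P-vanishes Q-vanishes ⟩
    + 0 ∎
    where open ≡-Reasoning

  module _ (k : ℕ) (u : List ℕ) (u⊆Mid : u ⊆ Mid) where

    private
      ordered : AllPairs InOrder u
      ordered = AllPairs-resp-⊆ u⊆Mid Mid-inOrder
      lowOrAboveB : All LowOrAboveB u
      lowOrAboveB = All-resp-⊆ u⊆Mid Mid-lowOrAboveB

    leq-cup-framedByAB : leq (cup (3 + k)) (A ∷ u ++ B ∷ []) ≡ matches (replicate (suc k) true) u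
    leq-cup-framedByAB = ≡true⇔⇒≡ (mk⇔
      (cup-framedByAB⇒ k u ordered ∘ Equivalence.to (leq-cup⇔ (suc k) _))
      (Equivalence.from (leq-cup⇔ (suc k) _) ∘ cup-framedByAB⇐ k u ordered lowOrAboveB))

    leq-cup-framedByA : leq (cup (3 + k)) (A ∷ u) ≡ matches (replicate (suc k) true ++ false ∷ []) u
    leq-cup-framedByA = ≡true⇔⇒≡ (mk⇔
      (cup-framedByA⇒ k u ordered ∘ Equivalence.to (leq-cup⇔ (suc k) _))
      (Equivalence.from (leq-cup⇔ (suc k) _) ∘ cup-framedByA⇐ k u ordered lowOrAboveB))

    leq-cup-framedByB : leq (cup (3 + k)) (u ++ B ∷ []) ≡ leq (cup (3 + k)) u
    leq-cup-framedByB = ≡true⇔⇒≡ (mk⇔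
      (Equivalence.from (leq-cup⇔ (suc k) u) ∘ cup-dropB k u ordered ∘ Equivalence.to (leq-cup⇔ (suc k) _))
      (λ le → let t , t⊆u , shaped = Equivalence.to (leq-cup⇔ (suc k) u) le
              in Equivalence.from (leq-cup⇔ (suc k) _) (t , ⊆-trans t⊆u (⊆P.++ʳ (B ∷ []) ⊆-refl) , shaped)))

    leq-cap-framedByAB : leq (cap (3 + k)) (A ∷ u ++ B ∷ []) ≡ matches (replicate (suc k) false) u
    leq-cap-framedByAB = ≡true⇔⇒≡ (mk⇔
      (cap-framedByAB⇒ k u ordered ∘ Equivalence.to (leq-cap⇔ (suc k) _))
      (Equivalence.from (leq-cap⇔ (suc k) _) ∘ cap-framedByAB⇐ k u ordered lowOrAboveB))

    leq-cap-framedByB : leq (cap (3 + k)) (u ++ B ∷ []) ≡ matches (true ∷ replicate (suc k) false) u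
    leq-cap-framedByB = ≡true⇔⇒≡ (mk⇔
      (cap-framedByB⇒ k u ordered lowOrAboveB ∘ Equivalence.to (leq-cap⇔ (suc k) _))
      (Equivalence.from (leq-cap⇔ (suc k) _) ∘ cap-framedByB⇐ k u ordered lowOrAboveB))

    leq-cap-framedByA : leq (cap (3 + k)) (A ∷ u) ≡ leq (cap (3 + k)) u
    leq-cap-framedByA = ≡true⇔⇒≡ (mk⇔
      (Equivalence.from (leq-cap⇔ (suc k) u) ∘ cap-dropA k u ordered ∘ Equivalence.to (leq-cap⇔ (suc k) _))
      (λ le → let t , t⊆u , shaped = Equivalence.to (leq-cap⇔ (suc k) u) le
              in Equivalence.from (leq-cap⇔ (suc k) _) (t , A ∷ʳ t⊆u , shaped)))

    cup-fourTerms : let e = sign (length u) in fourTerms (cup (3 + k)) u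
      ≡ [ matches (replicate (suc k) true) u ]· e +ℤ - [ matches (replicate (suc k) true ++ false ∷ []) u ]· e
    cup-fourTerms = trans (fourTerms-signs _ u) (begin
      ([ leq σ (A ∷ u ++ B ∷ []) ]· e +ℤ - [ leq σ (u ++ B ∷ []) ]· e) +ℤ (- [ leq σ (A ∷ u) ]· e +ℤ [ leq σ u ]· e)
        ≡⟨ cong₂ (λ p q → (p +ℤ - q) +ℤ (- [ leq σ (A ∷ u) ]· e +ℤ [ leq σ u ]· e))
             (cong ([_]· e) leq-cup-framedByAB) (cong ([_]· e) leq-cup-framedByB) ⟩
      ([ P ]· e +ℤ - [ leq σ u ]· e) +ℤ (- [ leq σ (A ∷ u) ]· e +ℤ [ leq σ u ]· e)
        ≡⟨ cong (λ q → ([ P ]· e +ℤ - [ leq σ u ]· e) +ℤ (- q +ℤ [ leq σ u ]· e)) (cong ([_]· e) leq-cup-framedByA) ⟩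
      ([ P ]· e +ℤ - [ leq σ u ]· e) +ℤ (- [ Q ]· e +ℤ [ leq σ u ]· e)
        ≡⟨ cancel ([ P ]· e) ([ leq σ u ]· e) ([ Q ]· e) ⟩
      [ P ]· e +ℤ - [ Q ]· e ∎)
      where
      open ≡-Reasoning
      σ : List ℕ
      σ = cup (3 + k)
      e : ℤ
      e = sign (length u)
      P Q : Bool
      P = matches (replicate (suc k) true) u
      Q = matches (replicate (suc k) true ++ false ∷ []) u
      cancel : ∀ p c q → (p +ℤ - c) +ℤ (- q +ℤ c) ≡ p +ℤ - q
      cancel = solve-∀

    cap-fourTerms : let e = sign (length u) in fourTerms (cap (3 + k)) u
      ≡ [ matches (replicate (suc k) false) u ]· e +ℤ - [ matches (true ∷ replicate (suc k) false) u ]· e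
    cap-fourTerms = trans (fourTerms-signs _ u) (begin
      ([ leq σ (A ∷ u ++ B ∷ []) ]· e +ℤ - [ leq σ (u ++ B ∷ []) ]· e) +ℤ (- [ leq σ (A ∷ u) ]· e +ℤ [ leq σ u ]· e)
        ≡⟨ cong₂ (λ p q → (p +ℤ - q) +ℤ (- [ leq σ (A ∷ u) ]· e +ℤ [ leq σ u ]· e))
             (cong ([_]· e) leq-cap-framedByAB) (cong ([_]· e) leq-cap-framedByB) ⟩
      ([ P ]· e +ℤ - [ Q ]· e) +ℤ (- [ leq σ (A ∷ u) ]· e +ℤ [ leq σ u ]· e)
        ≡⟨ cong (λ c → ([ P ]· e +ℤ - [ Q ]· e) +ℤ (- c +ℤ [ leq σ u ]· e)) (cong ([_]· e) leq-cap-framedByA) ⟩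
      ([ P ]· e +ℤ - [ Q ]· e) +ℤ (- [ leq σ u ]· e +ℤ [ leq σ u ]· e)
        ≡⟨ cancel ([ P ]· e) ([ leq σ u ]· e) ([ Q ]· e) ⟩
      [ P ]· e +ℤ - [ Q ]· e ∎)
      where
      open ≡-Reasoning
      σ : List ℕ
      σ = cap (3 + k)
      e : ℤ
      e = sign (length u)
      P Q : Bool
      P = matches (replicate (suc k) false) u
      Q = matches (true ∷ replicate (suc k) false) u
      cancel : ∀ p c q → (p +ℤ - q) +ℤ (- c +ℤ c) ≡ p +ℤ - q
      cancel = solve-∀

Mid-alternatingSum : ∀ n → 2 ≤ n → ∀ a b →
  alternatingSum (Classification.matches n (AlternatingMatches.lowsHighs n a b)) (PiStructure.Mid n) ≡ + 0
Mid-alternatingSum (suc (suc m)) (s≤s (s≤s _)) a b =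
  subst (λ L → alternatingSum (matches (lowsHighs a b)) L ≡ + 0) (sym (proj₂ Mid-shape))
  (alternatingSum-lowsHighs a b 1 (B + 1) 2 (proj₁ Mid-shape)
    (Equivalence.from low⇔≤ (s≤s z≤n)) (B<⇒high (ℕP.m<m+n B (s≤s z≤n))) (Equivalence.from low⇔≤ (s≤s (s≤s z≤n))))
  where
  open PiStructure (suc (suc m))
  open AlternatingMatches (suc (suc m))
  Mid-shape : ∃ λ rest → Mid ≡ 1 ∷ B + 1 ∷ 2 ∷ rest
  Mid-shape = _ , refl

∑χ-cup : ∀ n → 2 ≤ n → ∀ k → ∑ (χ (cup (3 + k))) (subseqs (πₙ n)) ≡ + 0
∑χ-cup n 2≤n k = ∑χ-cancellation (cup (3 + k)) _ _ (cup-fourTerms k)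
  (trans (alternatingSum-cong Mid (λ u → cong (λ w → matches w u) (sym (LP.++-identityʳ (replicate (suc k) true)))))
         (Mid-alternatingSum n 2≤n (suc k) 0))
  (Mid-alternatingSum n 2≤n (suc k) 1)
  where
  open Cancellation n
  open PiStructure n

∑χ-cap : ∀ n → 2 ≤ n → ∀ k → ∑ (χ (cap (3 + k))) (subseqs (πₙ n)) ≡ + 0
∑χ-cap n 2≤n k = ∑χ-cancellation (cap (3 + k)) _ _ (cap-fourTerms k)
  (Mid-alternatingSum n 2≤n 0 (suc k)) (Mid-alternatingSum n 2≤n 1 (suc k))
  where
  open Cancellation n
  open PiStructure n

lemma15 : (n m : ℕ) → 2 ≤ n → 3 ≤ m → (lam : Perm) →
            (lam ≡ cup m ⊎ lam ≡ cap m) → Vanishing n lam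
lemma15 n m 2≤n 3≤m lam cup-or-cap = begin
  μ p21 lam *ℤ sumℤ (map (λ τ → sign (length τ) *ℤ + E τ (πₙ n)) (interval lam (πₙ n)))
    ≡⟨ cong (μ p21 lam *ℤ_) (intervalSum≡∑χ lam (πₙ n)) ⟩
  μ p21 lam *ℤ ∑ (χ lam) (subseqs (πₙ n))
    ≡⟨ cong (μ p21 lam *ℤ_) (∑χ-vanishes m 3≤m cup-or-cap) ⟩
  μ p21 lam *ℤ + 0
    ≡⟨ ℤP.*-zeroʳ (μ p21 lam) ⟩
  + 0 ∎
  where
  open ≡-Reasoning
  ∑χ-vanishes : ∀ m → 3 ≤ m → lam ≡ cup m ⊎ lam ≡ cap m → ∑ (χ lam) (subseqs (πₙ n)) ≡ + 0
  ∑χ-vanishes (suc (suc (suc k))) (s≤s (s≤s (s≤s _))) (inj₁ refl) = ∑χ-cup n 2≤n k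
  ∑χ-vanishes (suc (suc (suc k))) (s≤s (s≤s (s≤s _))) (inj₂ refl) = ∑χ-cap n 2≤n k
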